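{- Let $\mathcal X'=(\Omega',\{R'_i\}_{i=0}^7)$ be an association scheme algebraically isomorphic to the flag scheme $\mathcal X=(\Omega,\{R_i\}_{i=0}^7)$ of a generalized quadrangle of order $(s,t)$, via an algebraic isomorphism $\phi$ with $R'_i=\phi(R_i)$. Let $e'_1=R'_0\cup R'_1$ and $e'_2=R'_0\cup R'_2$ (these are equivalence relations), and call their classes point-cliques and line-cliques respectively; a point-clique $C_1$ and a line-clique $C_2$ are incident if $C_1\cap C_2\neq\emptyset$. For $x\in\Omega'$ let $C_1(x)$, $C_2(x)$ be the point-clique and line-clique containing $x$. If a point-clique $C_1$ and a line-clique $C_2$ are incident with common vertex $z$, then $(x,y)\in R'_4$ for all $x\in C_1\setminus\{z\}$ and $y\in C_2\setminus\{z\}$. Conversely, if $(x,y)\in R'_4$ then $C_1(x)$ and $C_2(y)$ are incident.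
   Context: A finite generalized quadrangle of order $(s,t)$ is an incidence structure of points and lines in which each point is on $t+1$ lines, each line has $s+1$ points, two distinct points lie on at most one common line, two distinct lines share at most one point, and for every non-incident point $p$ and line $L$ there is a unique pair $(q,M)$ with $p\,\mathrm I\,M\,\mathrm I\,q\,\mathrm I\,L$. Its flag scheme $\mathcal X$: $\Omega$ is the set of incident pairs $(p,L)$, $R_0$ the diagonal, and for flags $(p,L),(q,M)$: $R_1$: $p=q$, $L\ne M$; $R_2$: $L=M$, $p\ne q$; $R_3$: $p\ne q$ collinear on $L$, $M\ne L$; $R_4$: $p\neq q$ collinear on $M$, $L\neq M$; $R_5$: $p\ne q$ collinear on a line different from $L$ and $M$; $R_6$: $L\ne M$ meet in a point $r\ne p,q$; $R_7$: $L,M$ disjoint and $p,q$ not collinear. This is an association scheme with intersection numbers $p^k_{ij}$ (the number of $z$ with $(x,z)\in R_i,(z,y)\in R_j$ for $(x,y)\in R_k$). An algebraic isomorphism from $\mathcal X$ to an association scheme $\mathcal X'$ is a bijection $\phi$ between their sets of basis relations such that the intersection numbers of $\mathcal X'$ satisfy $p'^{\phi(R_k)}_{\phi(R_i)\phi(R_j)}=p^k_{ij}$ for all $i,j,k$. -}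

module Defs where

open import Data.Nat using (ℕ; zero; suc; _+_)
open import Data.Bool using (Bool; true; false; _∧_; not)
open import Data.Fin using (Fin; zero; suc)
open import Data.Fin.Properties using (_≟_)
open import Data.Product using (Σ; _×_; _,_; ∃)
open import Relation.Nullary using (¬_)
open import Relation.Nullary.Decidable using (⌊_⌋)
open import Relation.Binary.PropositionalEquality using (_≡_; _≢_)

countFin : (n : ℕ) → (Fin n → Bool) → ℕ
countFin zero    f = 0
countFin (suc n) f with f zero
... | true  = suc (countFin n (λ i → f (suc i)))
... | false = countFin n (λ i → f (suc i))

anyFin : (n : ℕ) → (Fin n → Bool) → Bool
anyFin zero    f = false
anyFin (suc n) f with f zero
... | true  = true
... | false = anyFin n (λ i → f (suc i))

sumFin : (n : ℕ) → (Fin n → ℕ) → ℕ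
sumFin zero    f = 0
sumFin (suc n) f = f zero + sumFin n (λ i → f (suc i))

_=ᶠ_ : ∀ {n} → Fin n → Fin n → Bool
a =ᶠ b = ⌊ a ≟ b ⌋

record IsGQ (np nl s t : ℕ) (I : Fin np → Fin nl → Bool) : Set where
  field
    pointDeg : ∀ p → countFin nl (λ L → I p L) ≡ suc t
    lineDeg  : ∀ L → countFin np (λ p → I p L) ≡ suc s
    pointsOneLine : ∀ p q L M → p ≢ q →
      I p L ≡ true → I q L ≡ true → I p M ≡ true → I q M ≡ true → L ≡ M
    linesOnePoint : ∀ L M p q → L ≢ M →
      I p L ≡ true → I p M ≡ true → I q L ≡ true → I q M ≡ true → p ≡ q
    gqAxiom : ∀ p L → I p L ≡ false →
      Σ (Fin np × Fin nl) λ { (q , M) →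
        (I p M ≡ true × I q M ≡ true × I q L ≡ true) ×
        (∀ q′ M′ → I p M′ ≡ true → I q′ M′ ≡ true → I q′ L ≡ true →
           (q′ ≡ q × M′ ≡ M)) }

module FlagScheme {np nl : ℕ} (I : Fin np → Fin nl → Bool) where

  Pair : Set
  Pair = Fin np × Fin nl

  isFlag : Pair → Bool
  isFlag (p , L) = I p L

  flagRel : Fin 8 → Pair → Pair → Bool
  flagRel zero (p , L) (q , M) = (p =ᶠ q) ∧ (L =ᶠ M)
  flagRel (suc zero) (p , L) (q , M) = (p =ᶠ q) ∧ not (L =ᶠ M)
  flagRel (suc (suc zero)) (p , L) (q , M) = (L =ᶠ M) ∧ not (p =ᶠ q)
  flagRel (suc (suc (suc zero))) (p , L) (q , M) =
    not (p =ᶠ q) ∧ (I p L ∧ I q L) ∧ not (M =ᶠ L)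
  flagRel (suc (suc (suc (suc zero)))) (p , L) (q , M) =
    not (p =ᶠ q) ∧ (I p M ∧ I q M) ∧ not (L =ᶠ M)
  flagRel (suc (suc (suc (suc (suc zero))))) (p , L) (q , M) =
    not (p =ᶠ q) ∧
    anyFin nl (λ N → I p N ∧ I q N ∧ not (N =ᶠ L) ∧ not (N =ᶠ M))
  flagRel (suc (suc (suc (suc (suc (suc zero)))))) (p , L) (q , M) =
    not (L =ᶠ M) ∧
    anyFin np (λ r → I r L ∧ I r M ∧ not (r =ᶠ p) ∧ not (r =ᶠ q))
  flagRel (suc (suc (suc (suc (suc (suc (suc zero))))))) (p , L) (q , M) =
    not (anyFin np (λ r → I r L ∧ I r M)) ∧
    not (anyFin nl (λ N → I p N ∧ I q N))

  interFlag : Fin 8 → Fin 8 → Pair → Pair → ℕ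
  interFlag i j x y =
    sumFin np (λ p → countFin nl (λ L →
      isFlag (p , L) ∧ flagRel i x (p , L) ∧ flagRel j (p , L) y))

-- Association schemes with 8 classes on Ω' = Fin m, given by a colouring
-- c x y = index of the basis relation containing (x,y).

module _ {m : ℕ} (c : Fin m → Fin m → Fin 8) where

  interCol : Fin 8 → Fin 8 → Fin m → Fin m → ℕ
  interCol i j x y = countFin m (λ z → (c x z =ᶠ i) ∧ (c z y =ᶠ j))

  record IsAssocScheme : Set where
    field
      diag⇒ : ∀ x y → c x y ≡ zero → x ≡ y
      ⇒diag : ∀ x → c x x ≡ zero
      nonempty : ∀ i → Σ (Fin m × Fin m) λ { (x , y) → c x y ≡ i }
      transpose : ∀ i → Σ (Fin 8) λ j → ∀ x y → c x y ≡ i → c y x ≡ j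
      regular : ∀ i j k x y x′ y′ → c x y ≡ k → c x′ y′ ≡ k →
        interCol i j x y ≡ interCol i j x′ y′

{-# OPTIONS --safe #-}

-- An algebraic isomorphism preserves which intersection numbers vanish: a triangle x, z, y with
-- (x,z) ∈ φ(Rᵢ), (z,y) ∈ φ(Rⱼ), (x,y) ∈ φ(Rₖ) exists in 𝒳′ iff a flag triangle of types i, j, k
-- exists in 𝒳.  In the flag scheme R₁ and R₂ are symmetric, R₁R₂ ⊆ R₄, every R₄-pair
-- (p,L), (q,M) factors through the flag (p,M), and, because two points span at most one line and
-- two lines meet in at most one point, a pair of flags in R₁, R₂ or R₄ lies in no other relation.
-- Transporting these facts along φ gives φ(R₀) = R′₀, the symmetry of R′₁ and R′₂, R′₁R′₂ ⊆ R′₄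
-- and R′₄ ⊆ R′₁R′₂, from which both halves of the theorem follow.

module Submission where

open import Defs
open import Data.Nat using (ℕ; zero; suc)
open import Data.Nat.Properties using (1+n≢0; m+n≡0⇒m≡0; m+n≡0⇒n≡0)
open import Data.Bool using (Bool; true; false; _∧_; not)
open import Data.Fin using (Fin; #_; zero; suc)
open import Data.Fin.Patterns using (0F; 1F; 2F; 3F; 4F; 5F; 6F; 7F)
open import Data.Fin.Properties using (_≟_)
open import Data.Product using (Σ; _×_; _,_; ∃; proj₁; proj₂)
open import Data.Product.Properties using (×-≡,≡→≡)
open import Data.Sum using (_⊎_; inj₁; inj₂)
open import Data.Empty using (⊥; ⊥-elim)
open import Function using (_∘_)
open import Function.Bundles using (_↔_; Inverse)
open import Relation.Nullary using (yes; no)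
open import Relation.Binary.PropositionalEquality
  using (_≡_; _≢_; refl; sym; trans; cong; subst; module ≡-Reasoning)

∧-elim : ∀ a {b} → a ∧ b ≡ true → a ≡ true × b ≡ true
∧-elim true b≡true = refl , b≡true

∧-intro : ∀ {a b} → a ≡ true → b ≡ true → a ∧ b ≡ true
∧-intro refl refl = refl

not-true⇒≢true : ∀ {b} → not b ≡ true → b ≢ true
not-true⇒≢true {false} _ ()

=ᶠ⇒≡ : ∀ {n} {a b : Fin n} → (a =ᶠ b) ≡ true → a ≡ b
=ᶠ⇒≡ {a = a} {b} h with a ≟ b | h
... | yes a≡b | _ = a≡b
... | no _    | ()

=ᶠ-refl : ∀ {n} (a : Fin n) → (a =ᶠ a) ≡ true
=ᶠ-refl a with a ≟ a
... | yes _  = refl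
... | no a≢a = ⊥-elim (a≢a refl)

≡⇒=ᶠ : ∀ {n} {a b : Fin n} → a ≡ b → (a =ᶠ b) ≡ true
≡⇒=ᶠ {a = a} refl = =ᶠ-refl a

not=ᶠ⇒≢ : ∀ {n} {a b : Fin n} → not (a =ᶠ b) ≡ true → a ≢ b
not=ᶠ⇒≢ {a = a} {b} h with a ≟ b | h
... | no a≢b | _ = a≢b
... | yes _  | ()

≢⇒not=ᶠ : ∀ {n} {a b : Fin n} → a ≢ b → not (a =ᶠ b) ≡ true
≢⇒not=ᶠ {a = a} {b} a≢b with a ≟ b
... | yes a≡b = ⊥-elim (a≢b a≡b)
... | no _    = refl

countFin-witness : ∀ n (f : Fin n → Bool) → countFin n f ≢ 0 → ∃ λ i → f i ≡ true
countFin-witness zero    f count≢0 = ⊥-elim (count≢0 refl)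
countFin-witness (suc n) f count≢0 with f zero in f0
... | true  = zero , f0
... | false = let (i , fi) = countFin-witness n (f ∘ suc) count≢0 in suc i , fi

countFin-nonzero : ∀ n (f : Fin n → Bool) i → f i ≡ true → countFin n f ≢ 0
countFin-nonzero (suc n) f i fi count≡0 with f zero in f0
countFin-nonzero (suc n) f zero    fi () | true
countFin-nonzero (suc n) f (suc i) fi () | true
countFin-nonzero (suc n) f zero    fi count≡0 | false with () ← trans (sym f0) fi
countFin-nonzero (suc n) f (suc i) fi count≡0 | false = countFin-nonzero n (f ∘ suc) i fi count≡0

anyFin-witness : ∀ n (f : Fin n → Bool) → anyFin n f ≡ true → ∃ λ i → f i ≡ true
anyFin-witness (suc n) f any with f zero in f0
... | true  = zero , f0
... | false = let (i , fi) = anyFin-witness n (f ∘ suc) any in suc i , fi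

anyFin-true : ∀ n (f : Fin n → Bool) i → f i ≡ true → anyFin n f ≡ true
anyFin-true (suc n) f i fi with f zero in f0
anyFin-true (suc n) f i       fi | true  = refl
anyFin-true (suc n) f zero    fi | false with () ← trans (sym f0) fi
anyFin-true (suc n) f (suc i) fi | false = anyFin-true n (f ∘ suc) i fi

sumFin-witness : ∀ n (g : Fin n → ℕ) → sumFin n g ≢ 0 → ∃ λ i → g i ≢ 0
sumFin-witness zero    g sum≢0 = ⊥-elim (sum≢0 refl)
sumFin-witness (suc n) g sum≢0 with g zero in g0
... | suc _ = zero , λ g0≡0 → 1+n≢0 (trans (sym g0) g0≡0)
... | zero  = let (i , gi≢0) = sumFin-witness n (g ∘ suc) sum≢0 in suc i , gi≢0

sumFin-nonzero : ∀ n (g : Fin n → ℕ) i → g i ≢ 0 → sumFin n g ≢ 0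
sumFin-nonzero (suc n) g zero    g0≢0 sum≡0 = g0≢0 (m+n≡0⇒m≡0 (g zero) sum≡0)
sumFin-nonzero (suc n) g (suc i) gi≢0 sum≡0 =
  sumFin-nonzero n (g ∘ suc) i gi≢0 (m+n≡0⇒n≡0 (g zero) sum≡0)

module FlagRelations {np nl : ℕ} (I : Fin np → Fin nl → Bool) where
  open FlagScheme I

  flagRel₀⇒≡ : ∀ X Y → flagRel 0F X Y ≡ true → X ≡ Y
  flagRel₀⇒≡ (p , L) (q , M) h =
    let (p=q , L=M) = ∧-elim (p =ᶠ q) h in ×-≡,≡→≡ (=ᶠ⇒≡ p=q , =ᶠ⇒≡ L=M)

  flagRel₀-refl : ∀ X → flagRel 0F X X ≡ true
  flagRel₀-refl (p , L) = ∧-intro (=ᶠ-refl p) (=ᶠ-refl L)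

  flagRel₁-elim : ∀ p L q M → flagRel 1F (p , L) (q , M) ≡ true → p ≡ q × L ≢ M
  flagRel₁-elim p L q M h =
    let (p=q , L≠M) = ∧-elim (p =ᶠ q) h in =ᶠ⇒≡ p=q , not=ᶠ⇒≢ L≠M

  flagRel₁-intro : ∀ p L M → L ≢ M → flagRel 1F (p , L) (p , M) ≡ true
  flagRel₁-intro p L M L≢M = ∧-intro (=ᶠ-refl p) (≢⇒not=ᶠ L≢M)

  flagRel₂-elim : ∀ p L q M → flagRel 2F (p , L) (q , M) ≡ true → L ≡ M × p ≢ q
  flagRel₂-elim p L q M h =
    let (L=M , p≠q) = ∧-elim (L =ᶠ M) h in =ᶠ⇒≡ L=M , not=ᶠ⇒≢ p≠q

  flagRel₂-intro : ∀ p q L → p ≢ q → flagRel 2F (p , L) (q , L) ≡ true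
  flagRel₂-intro p q L p≢q = ∧-intro (=ᶠ-refl L) (≢⇒not=ᶠ p≢q)

  flagRel₃-elim : ∀ p L q M → flagRel 3F (p , L) (q , M) ≡ true →
    p ≢ q × I p L ≡ true × I q L ≡ true × M ≢ L
  flagRel₃-elim p L q M h =
    let (p≠q , rest)   = ∧-elim (not (p =ᶠ q)) h
        (pqL , M≠L)    = ∧-elim (I p L ∧ I q L) rest
        (pL , qL)      = ∧-elim (I p L) pqL
    in not=ᶠ⇒≢ p≠q , pL , qL , not=ᶠ⇒≢ M≠L

  flagRel₄-elim : ∀ p L q M → flagRel 4F (p , L) (q , M) ≡ true →
    p ≢ q × I p M ≡ true × I q M ≡ true × L ≢ M
  flagRel₄-elim p L q M h =
    let (p≠q , rest)   = ∧-elim (not (p =ᶠ q)) h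
        (pqM , L≠M)    = ∧-elim (I p M ∧ I q M) rest
        (pM , qM)      = ∧-elim (I p M) pqM
    in not=ᶠ⇒≢ p≠q , pM , qM , not=ᶠ⇒≢ L≠M

  flagRel₄-intro : ∀ p L q M → p ≢ q → I p M ≡ true → I q M ≡ true → L ≢ M →
    flagRel 4F (p , L) (q , M) ≡ true
  flagRel₄-intro p L q M p≢q pM qM L≢M =
    ∧-intro (≢⇒not=ᶠ p≢q) (∧-intro (∧-intro pM qM) (≢⇒not=ᶠ L≢M))

  flagRel₅-elim : ∀ p L q M → flagRel 5F (p , L) (q , M) ≡ true →
    p ≢ q × ∃ λ N → I p N ≡ true × I q N ≡ true × N ≢ L × N ≢ M
  flagRel₅-elim p L q M h =
    let (p≠q , any)    = ∧-elim (not (p =ᶠ q)) h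
        (N , hN)       = anyFin-witness nl (λ N → I p N ∧ I q N ∧ not (N =ᶠ L) ∧ not (N =ᶠ M)) any
        (pN , rest)    = ∧-elim (I p N) hN
        (qN , rest′)   = ∧-elim (I q N) rest
        (N≠L , N≠M)    = ∧-elim (not (N =ᶠ L)) rest′
    in not=ᶠ⇒≢ p≠q , N , pN , qN , not=ᶠ⇒≢ N≠L , not=ᶠ⇒≢ N≠M

  flagRel₆-elim : ∀ p L q M → flagRel 6F (p , L) (q , M) ≡ true →
    L ≢ M × ∃ λ r → I r L ≡ true × I r M ≡ true × r ≢ p × r ≢ q
  flagRel₆-elim p L q M h =
    let (L≠M , any)    = ∧-elim (not (L =ᶠ M)) h
        (r , hr)       = anyFin-witness np (λ r → I r L ∧ I r M ∧ not (r =ᶠ p) ∧ not (r =ᶠ q)) any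
        (rL , rest)    = ∧-elim (I r L) hr
        (rM , rest′)   = ∧-elim (I r M) rest
        (r≠p , r≠q)    = ∧-elim (not (r =ᶠ p)) rest′
    in not=ᶠ⇒≢ L≠M , r , rL , rM , not=ᶠ⇒≢ r≠p , not=ᶠ⇒≢ r≠q

  flagRel₇-elim : ∀ p L q M → flagRel 7F (p , L) (q , M) ≡ true →
    (∀ r → I r L ≡ true → I r M ≡ true → ⊥) × (∀ N → I p N ≡ true → I q N ≡ true → ⊥)
  flagRel₇-elim p L q M h =
    let (noMeet , noJoin) = ∧-elim (not (anyFin np (λ r → I r L ∧ I r M))) h
    in (λ r rL rM → not-true⇒≢true noMeet
                      (anyFin-true np (λ r → I r L ∧ I r M) r (∧-intro rL rM))) ,
       (λ N pN qN → not-true⇒≢true noJoin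
                      (anyFin-true nl (λ N → I p N ∧ I q N) N (∧-intro pN qN)))

  flagRel₁-sym : ∀ X Y → flagRel 1F X Y ≡ true → flagRel 1F Y X ≡ true
  flagRel₁-sym (p , L) (q , M) h with flagRel₁-elim p L q M h
  ... | refl , L≢M = flagRel₁-intro p M L (L≢M ∘ sym)

  flagRel₂-sym : ∀ X Y → flagRel 2F X Y ≡ true → flagRel 2F Y X ≡ true
  flagRel₂-sym (p , L) (q , M) h with flagRel₂-elim p L q M h
  ... | refl , p≢q = flagRel₂-intro q p L (p≢q ∘ sym)

  flagRel₁∘₂⇒flagRel₄ : ∀ X Z Y → isFlag Z ≡ true → isFlag Y ≡ true →
    flagRel 1F X Z ≡ true → flagRel 2F Z Y ≡ true → flagRel 4F X Y ≡ true
  flagRel₁∘₂⇒flagRel₄ (p , L) (p′ , M) (q , M′) fZ fY h₁ h₂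
    with flagRel₁-elim p L p′ M h₁ | flagRel₂-elim p′ M q M′ h₂
  ... | refl , L≢M | refl , p≢q = flagRel₄-intro p L q M p≢q fZ fY L≢M

  interFlag-witness : ∀ i j X Y → interFlag i j X Y ≢ 0 →
    ∃ λ Z → isFlag Z ≡ true × flagRel i X Z ≡ true × flagRel j Z Y ≡ true
  interFlag-witness i j X Y inter≢0 =
    let (p , count≢0) = sumFin-witness np _ inter≢0
        (L , hL)      = countFin-witness nl _ count≢0
        (pL , rest)   = ∧-elim (I p L) hL
        (iXZ , jZY)   = ∧-elim (flagRel i X (p , L)) rest
    in (p , L) , pL , iXZ , jZY

  interFlag-nonzero : ∀ i j X Y Z → isFlag Z ≡ true → flagRel i X Z ≡ true → flagRel j Z Y ≡ true →
    interFlag i j X Y ≢ 0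
  interFlag-nonzero i j X Y (p , L) fZ iXZ jZY =
    sumFin-nonzero np _ p (countFin-nonzero nl _ L (∧-intro fZ (∧-intro iXZ jZY)))

  record FlagTriangle (i j k : Fin 8) : Set where
    field
      {X Y Z} : Pair
      X-flag  : isFlag X ≡ true
      Y-flag  : isFlag Y ≡ true
      Z-flag  : isFlag Z ≡ true
      k-XY    : flagRel k X Y ≡ true
      i-XZ    : flagRel i X Z ≡ true
      j-ZY    : flagRel j Z Y ≡ true

record IsPartialLinearSpace {np nl : ℕ} (I : Fin np → Fin nl → Bool) : Set where
  field
    pointsOneLine : ∀ p q L M → p ≢ q →
      I p L ≡ true → I q L ≡ true → I p M ≡ true → I q M ≡ true → L ≡ M
    linesOnePoint : ∀ L M p q → L ≢ M →
      I p L ≡ true → I p M ≡ true → I q L ≡ true → I q M ≡ true → p ≡ q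

IsGQ⇒IsPartialLinearSpace : ∀ {np nl s t I} → IsGQ np nl s t I → IsPartialLinearSpace I
IsGQ⇒IsPartialLinearSpace gq = record
  { pointsOneLine = IsGQ.pointsOneLine gq
  ; linesOnePoint = IsGQ.linesOnePoint gq
  }

module FlagRelationsUnique
  {np nl : ℕ} {I : Fin np → Fin nl → Bool} (pls : IsPartialLinearSpace I) where
  open FlagScheme I
  open FlagRelations I
  open IsPartialLinearSpace pls

  flagRel₁-unique : ∀ a X Y → isFlag X ≡ true → isFlag Y ≡ true →
    flagRel 1F X Y ≡ true → flagRel a X Y ≡ true → a ≡ 1F
  flagRel₁-unique a (p , L) (q , M) pL pM h₁ with flagRel₁-elim p L q M h₁
  ... | refl , L≢M = unique a
    where
    unique : ∀ a → flagRel a (p , L) (p , M) ≡ true → a ≡ 1F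
    unique 0F h = ⊥-elim (L≢M (cong proj₂ (flagRel₀⇒≡ _ _ h)))
    unique 1F h = refl
    unique 2F h = ⊥-elim (L≢M (proj₁ (flagRel₂-elim p L p M h)))
    unique 3F h = ⊥-elim (proj₁ (flagRel₃-elim p L p M h) refl)
    unique 4F h = ⊥-elim (proj₁ (flagRel₄-elim p L p M h) refl)
    unique 5F h = ⊥-elim (proj₁ (flagRel₅-elim p L p M h) refl)
    unique 6F h with flagRel₆-elim p L p M h
    ... | _ , r , rL , rM , r≢p , _ = ⊥-elim (r≢p (linesOnePoint L M r p L≢M rL rM pL pM))
    unique 7F h = ⊥-elim (proj₁ (flagRel₇-elim p L p M h) p pL pM)

  flagRel₂-unique : ∀ a X Y → isFlag X ≡ true → isFlag Y ≡ true →
    flagRel 2F X Y ≡ true → flagRel a X Y ≡ true → a ≡ 2F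
  flagRel₂-unique a (p , L) (q , M) pL qL h₂ with flagRel₂-elim p L q M h₂
  ... | refl , p≢q = unique a
    where
    unique : ∀ a → flagRel a (p , L) (q , L) ≡ true → a ≡ 2F
    unique 0F h = ⊥-elim (p≢q (cong proj₁ (flagRel₀⇒≡ _ _ h)))
    unique 1F h = ⊥-elim (p≢q (proj₁ (flagRel₁-elim p L q L h)))
    unique 2F h = refl
    unique 3F h = ⊥-elim (proj₂ (proj₂ (proj₂ (flagRel₃-elim p L q L h))) refl)
    unique 4F h = ⊥-elim (proj₂ (proj₂ (proj₂ (flagRel₄-elim p L q L h))) refl)
    unique 5F h with flagRel₅-elim p L q L h
    ... | _ , N , pN , qN , N≢L , _ = ⊥-elim (N≢L (pointsOneLine p q N L p≢q pN qN pL qL))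
    unique 6F h = ⊥-elim (proj₁ (flagRel₆-elim p L q L h) refl)
    unique 7F h = ⊥-elim (proj₁ (flagRel₇-elim p L q L h) p pL pL)

  flagRel₄-unique : ∀ a X Y → isFlag X ≡ true → isFlag Y ≡ true →
    flagRel 4F X Y ≡ true → flagRel a X Y ≡ true → a ≡ 4F
  flagRel₄-unique a (p , L) (q , M) pL qM h₄ with flagRel₄-elim p L q M h₄
  ... | p≢q , pM , _ , L≢M = unique a
    where
    unique : ∀ a → flagRel a (p , L) (q , M) ≡ true → a ≡ 4F
    unique 0F h = ⊥-elim (p≢q (cong proj₁ (flagRel₀⇒≡ _ _ h)))
    unique 1F h = ⊥-elim (p≢q (proj₁ (flagRel₁-elim p L q M h)))
    unique 2F h = ⊥-elim (L≢M (proj₁ (flagRel₂-elim p L q M h)))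
    unique 3F h with flagRel₃-elim p L q M h
    ... | _ , _ , qL , _ = ⊥-elim (L≢M (pointsOneLine p q L M p≢q pL qL pM qM))
    unique 4F h = refl
    unique 5F h with flagRel₅-elim p L q M h
    ... | _ , N , pN , qN , _ , N≢M = ⊥-elim (N≢M (pointsOneLine p q N M p≢q pN qN pM qM))
    unique 6F h with flagRel₆-elim p L q M h
    ... | _ , r , rL , rM , r≢p , _ = ⊥-elim (r≢p (linesOnePoint L M r p L≢M rL rM pL pM))
    unique 7F h = ⊥-elim (proj₂ (flagRel₇-elim p L q M h) M pM qM)

interCol-witness : ∀ {m} (c : Fin m → Fin m → Fin 8) i j x y → interCol c i j x y ≢ 0 →
  ∃ λ z → c x z ≡ i × c z y ≡ j
interCol-witness {m} c i j x y inter≢0 =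
  let (z , hz)     = countFin-witness m _ inter≢0
      (xz=i , zy=j) = ∧-elim (c x z =ᶠ i) hz
  in z , =ᶠ⇒≡ xz=i , =ᶠ⇒≡ zy=j

interCol-nonzero : ∀ {m} (c : Fin m → Fin m → Fin 8) i j x y z → c x z ≡ i → c z y ≡ j →
  interCol c i j x y ≢ 0
interCol-nonzero {m} c i j x y z xz≡i zy≡j =
  countFin-nonzero m _ z (∧-intro (≡⇒=ᶠ xz≡i) (≡⇒=ᶠ zy≡j))

FlagRelationsNonempty : ∀ {np nl} → (Fin np → Fin nl → Bool) → Set
FlagRelationsNonempty I = ∀ k → Σ (Pair × Pair) λ { (X , Y) →
  isFlag X ≡ true × isFlag Y ≡ true × flagRel k X Y ≡ true }
  where open FlagScheme I

IsAlgebraicIsomorphism : ∀ {np nl m} →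
  (Fin np → Fin nl → Bool) → (Fin m → Fin m → Fin 8) → (Fin 8 → Fin 8) → Set
IsAlgebraicIsomorphism I c φ = ∀ i j k X Y x y →
  isFlag X ≡ true → isFlag Y ≡ true → flagRel k X Y ≡ true → c x y ≡ φ k →
  interCol c (φ i) (φ j) x y ≡ interFlag i j X Y
  where open FlagScheme I

module AlgebraicIsomorphism
  {np nl : ℕ} {I : Fin np → Fin nl → Bool} (pls : IsPartialLinearSpace I)
  (flagRel-nonempty : FlagRelationsNonempty I)
  {m : ℕ} {c : Fin m → Fin m → Fin 8} (scheme : IsAssocScheme c)
  (φ : Fin 8 ↔ Fin 8) (interCol≡interFlag : IsAlgebraicIsomorphism I c (Inverse.to φ))
  where
  open FlagScheme I
  open FlagRelations I
  open FlagRelationsUnique pls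
  open IsAssocScheme scheme
  open ≡-Reasoning

  φ⃗ : Fin 8 → Fin 8
  φ⃗ = Inverse.to φ

  φ⃖ : Fin 8 → Fin 8
  φ⃖ = Inverse.from φ

  R′ : Fin 8 → Fin m → Fin m → Set
  R′ k x y = c x y ≡ φ⃗ k

  φ⃗∘φ⃖ : ∀ a → φ⃗ (φ⃖ a) ≡ a
  φ⃗∘φ⃖ = Inverse.strictlyInverseˡ φ

  R′-colour : ∀ x y → R′ (φ⃖ (c x y)) x y
  R′-colour x y = sym (φ⃗∘φ⃖ (c x y))

  R′-triangle⇒FlagTriangle : ∀ {i j k x y z} → R′ k x y → R′ i x z → R′ j z y → FlagTriangle i j k
  R′-triangle⇒FlagTriangle {i} {j} {k} {x} {y} {z} kxy ixz jzy =
    let ((X , Y) , fX , fY , kXY) = flagRel-nonempty k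
        inter≡ = interCol≡interFlag i j k X Y x y fX fY kXY kxy
        (Z , fZ , iXZ , jZY) = interFlag-witness i j X Y
          (λ inter≡0 → interCol-nonzero c (φ⃗ i) (φ⃗ j) x y z ixz jzy (trans inter≡ inter≡0))
    in record { X-flag = fX ; Y-flag = fY ; Z-flag = fZ ; k-XY = kXY ; i-XZ = iXZ ; j-ZY = jZY }

  FlagTriangle⇒R′-triangle : ∀ {i j k x y} →
    FlagTriangle i j k → R′ k x y → ∃ λ w → R′ i x w × R′ j w y
  FlagTriangle⇒R′-triangle {i} {j} {k} {x} {y} t kxy =
    let open FlagTriangle t
        inter≡ = interCol≡interFlag i j k X Y x y X-flag Y-flag k-XY kxy
    in interCol-witness c (φ⃗ i) (φ⃗ j) x y
         (λ inter≡0 → interFlag-nonzero i j X Y Z Z-flag i-XZ j-ZY (trans (sym inter≡) inter≡0))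

  -- For k = φ⁻¹(R′₀), a vertex w with (x₀,w) ∈ φ(Rₖ) = R′₀ and (w,x₀) ∈ φ(R₀) exists since
  -- p^k_{k0} ≠ 0; then w = x₀, so φ(R₀) contains a diagonal pair.
  φ⃗-diagonal : φ⃗ 0F ≡ 0F
  φ⃗-diagonal =
    let k = φ⃖ 0F
        x₀ = proj₁ (proj₁ (nonempty 0F))
        ((X , Y) , fX , fY , kXY) = flagRel-nonempty k
        triangle : FlagTriangle k 0F k
        triangle = record
          { X-flag = fX ; Y-flag = fY ; Z-flag = fY
          ; k-XY = kXY ; i-XZ = kXY ; j-ZY = flagRel₀-refl Y }
        (w , kx₀w , 0wx₀) = FlagTriangle⇒R′-triangle triangle (trans (⇒diag x₀) (sym (φ⃗∘φ⃖ 0F)))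
    in begin
      φ⃗ 0F     ≡⟨ sym 0wx₀ ⟩
      c w x₀   ≡⟨ cong (λ v → c v x₀) (sym (diag⇒ x₀ w (trans kx₀w (φ⃗∘φ⃖ 0F)))) ⟩
      c x₀ x₀  ≡⟨ ⇒diag x₀ ⟩
      0F       ∎

  R′₀-refl : ∀ x → R′ 0F x x
  R′₀-refl x = trans (⇒diag x) (sym φ⃗-diagonal)

  R′₀⇒≡ : ∀ {x y} → R′ 0F x y → x ≡ y
  R′₀⇒≡ {x} {y} xy = diag⇒ x y (trans xy φ⃗-diagonal)

  -- If (x,y) ∈ φ(Rₖ) and (y,x) ∈ φ(Rⱼ) then p^0_{kj} ≠ 0, so some flags satisfy X Rₖ Z and Z Rⱼ X;
  -- as Rₖ is symmetric, Z Rₖ X as well, and uniqueness of Rₖ forces j = k.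
  R′-sym : ∀ k →
    (∀ X Y → flagRel k X Y ≡ true → flagRel k Y X ≡ true) →
    (∀ a X Y → isFlag X ≡ true → isFlag Y ≡ true →
      flagRel k X Y ≡ true → flagRel a X Y ≡ true → a ≡ k) →
    ∀ {x y} → R′ k x y → R′ k y x
  R′-sym k flagRel-sym flagRel-unique {x} {y} kxy =
    let open FlagTriangle (R′-triangle⇒FlagTriangle (R′₀-refl x) kxy (R′-colour y x))
        jZX = subst (λ W → flagRel (φ⃖ (c y x)) Z W ≡ true) (sym (flagRel₀⇒≡ X Y k-XY)) j-ZY
    in trans (R′-colour y x) (cong φ⃗ (flagRel-unique _ Z X Z-flag X-flag (flagRel-sym X Z i-XZ) jZX))

  R′₁-sym : ∀ {x y} → R′ 1F x y → R′ 1F y x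
  R′₁-sym = R′-sym 1F flagRel₁-sym flagRel₁-unique

  R′₂-sym : ∀ {x y} → R′ 2F x y → R′ 2F y x
  R′₂-sym = R′-sym 2F flagRel₂-sym flagRel₂-unique

  R′₁∘R′₂⇒R′₄ : ∀ {x y z} → R′ 1F x z → R′ 2F z y → R′ 4F x y
  R′₁∘R′₂⇒R′₄ {x} {y} xz zy =
    let open FlagTriangle (R′-triangle⇒FlagTriangle (R′-colour x y) xz zy)
        h₄ = flagRel₁∘₂⇒flagRel₄ X Z Y Z-flag Y-flag i-XZ j-ZY
    in trans (R′-colour x y) (cong φ⃗ (flagRel₄-unique _ X Y X-flag Y-flag h₄ k-XY))

  R′₄⇒R′₁∘R′₂ : ∀ {x y} → R′ 4F x y → ∃ λ w → R′ 1F x w × R′ 2F w y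
  R′₄⇒R′₁∘R′₂ xy =
    let (((p , L) , (q , M)) , pL , qM , h₄) = flagRel-nonempty 4F
        (p≢q , pM , _ , L≢M) = flagRel₄-elim p L q M h₄
        triangle : FlagTriangle 1F 2F 4F
        triangle = record
          { X-flag = pL ; Y-flag = qM ; Z-flag = pM ; k-XY = h₄
          ; i-XZ = flagRel₁-intro p L M L≢M ; j-ZY = flagRel₂-intro p q M p≢q }
    in FlagTriangle⇒R′-triangle triangle xy

  e₁ e₂ : Fin m → Fin m → Set
  e₁ x y = R′ 0F x y ⊎ R′ 1F x y
  e₂ x y = R′ 0F x y ⊎ R′ 2F x y

  incident-cliques⇒R′₄ : ∀ z x y → e₁ z x → x ≢ z → e₂ z y → y ≢ z → R′ 4F x y
  incident-cliques⇒R′₄ z x y (inj₁ zx) x≢z _         _   = ⊥-elim (x≢z (sym (R′₀⇒≡ zx)))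
  incident-cliques⇒R′₄ z x y (inj₂ _)  _   (inj₁ zy) y≢z = ⊥-elim (y≢z (sym (R′₀⇒≡ zy)))
  incident-cliques⇒R′₄ z x y (inj₂ zx) _   (inj₂ zy) _   = R′₁∘R′₂⇒R′₄ (R′₁-sym zx) zy

  R′₄⇒incident-cliques : ∀ x y → R′ 4F x y → ∃ λ w → e₁ x w × e₂ y w
  R′₄⇒incident-cliques x y xy =
    let (w , xw , wy) = R′₄⇒R′₁∘R′₂ xy in w , inj₂ xw , inj₂ (R′₂-sym wy)

mainTheorem6 :
  (np nl s t : ℕ) (I : Fin np → Fin nl → Bool) → IsGQ np nl s t I →
  let open FlagScheme I in
  -- the flag scheme has 8 nonempty basis relations
  (∀ k → Σ (Pair × Pair) λ { (x , y) →
      isFlag x ≡ true × isFlag y ≡ true × flagRel k x y ≡ true }) →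
  (m : ℕ) (c : Fin m → Fin m → Fin 8) → IsAssocScheme c →
  -- algebraic isomorphism φ : R_i ↦ R'_i := φ(R_i) (colour φ i)
  (φ : Fin 8 ↔ Fin 8) →
  let φf = Inverse.to φ in
  (∀ i j k x y x′ y′ →
      isFlag x ≡ true → isFlag y ≡ true → flagRel k x y ≡ true →
      c x′ y′ ≡ φf k →
      interCol c (φf i) (φf j) x′ y′ ≡ interFlag i j x y) →
  let R′ : Fin 8 → Fin m → Fin m → Set
      R′ i x y = c x y ≡ φf i
      e₁ : Fin m → Fin m → Set
      e₁ x y = R′ (# 0) x y ⊎ R′ (# 1) x y
      e₂ : Fin m → Fin m → Set
      e₂ x y = R′ (# 0) x y ⊎ R′ (# 2) x y
  in
  -- C₁(z), C₂(z) incident with common vertex z; x ∈ C₁(z)∖{z}, y ∈ C₂(z)∖{z}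
  (∀ z x y → e₁ z x → x ≢ z → e₂ z y → y ≢ z → R′ (# 4) x y)
  ×
  -- (x,y) ∈ R'_4 implies C₁(x) ∩ C₂(y) ≠ ∅
  (∀ x y → R′ (# 4) x y → Σ (Fin m) λ w → e₁ x w × e₂ y w)
mainTheorem6 np nl s t I gq flagRel-nonempty m c scheme φ interCol≡interFlag =
  incident-cliques⇒R′₄ , R′₄⇒incident-cliques
  where
  open AlgebraicIsomorphism
    (IsGQ⇒IsPartialLinearSpace gq) flagRel-nonempty scheme φ interCol≡interFlag
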